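{- Let $\Gamma=\langle R_0,R_1,R_2\mid R_0^2=R_1^2=R_2^2=(R_0R_2)^2=1\rangle$, let $\Gamma^+$ be its subgroup of index $2$ consisting of words of even length in the generators, and let $\mathcal{M}$ be a map with map subgroup $M\le\Gamma$, where $M\not\le\Gamma^+$ (i.e. $\mathcal{M}$ is non-orientable or has non-empty boundary). Put $M^+=M\cap\Gamma^+$. If $\mathcal{M}$ is regular, then $\mathcal{M}$ is stable, i.e. $N_\Gamma(M^+)=N_\Gamma(M)$; equivalently, the subgroup ${\rm Aut}\,\mathcal{M}\times C_2$ of ${\rm Aut}\,\widetilde{\mathcal{M}}$ (obtained by lifting automorphisms of $\mathcal{M}$ to its canonical orientable double cover $\widetilde{\mathcal{M}}$) is the whole of ${\rm Aut}\,\widetilde{\mathcal{M}}$.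
   Context: Maps are connected and are identified with transitive permutation representations of $\Gamma$ on the set $\Phi$ of flags (incident vertex–edge–face triples), $R_i$ changing the $i$-dimensional component of a flag whenever possible and fixing flags at the boundary otherwise. A map subgroup $M$ of $\mathcal{M}$ is the stabiliser in $\Gamma$ of a flag; ${\rm Aut}\,\mathcal{M}$ (the permutations of $\Phi$ commuting with $\Gamma$) is isomorphic to $N_\Gamma(M)/M$. $\mathcal{M}$ is regular if ${\rm Aut}\,\mathcal{M}$ acts transitively on flags, equivalently $M$ is normal in $\Gamma$. $\mathcal{M}$ is orientable with empty boundary iff $M\le\Gamma^+$. If $M\not\le\Gamma^+$, the canonical orientable double cover $\widetilde{\mathcal{M}}$ is the map with map subgroup $M^+=M\cap\Gamma^+$, so ${\rm Aut}\,\widetilde{\mathcal{M}}\cong N_\Gamma(M^+)/M^+$, which contains a subgroup corresponding to $N_\Gamma(M)/M^+\cong {\rm Aut}\,\mathcal{M}\times C_2$. The map $\mathcal{M}$ is called stable if this subgroup is all of ${\rm Aut}\,\widetilde{\mathcal{M}}$, equivalently $N_\Gamma(M^+)=N_\Gamma(M)$, and unstable otherwise. -}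

module Defs where

open import Data.Nat using (ℕ; zero; suc)
open import Data.List using (List; []; _∷_; _++_; reverse; length)
open import Data.Product using (_×_; Σ)
open import Relation.Nullary using (¬_)

data Gen : Set where
  R₀ R₁ R₂ : Gen

Word : Set
Word = List Gen

-- Group operations on words: product is concatenation, identity is the
-- empty word, and (all generators being involutions) the inverse of a
-- word is its reversal.
_·_ : Word → Word → Word
u · v = u ++ v

e : Word
e = []

_⁻¹ : Word → Word
w ⁻¹ = reverse w

-- Equality in Γ: the congruence on words generated by the relators.
-- R_i R_i = 1, and (R₀R₂)² = 1 in the equivalent form R₀R₂ = R₂R₀.
data _≈_ : Word → Word → Set where
  ≈-refl  : ∀ {u} → u ≈ u
  ≈-sym   : ∀ {u v} → u ≈ v → v ≈ u
  ≈-trans : ∀ {u v w} → u ≈ v → v ≈ w → u ≈ w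
  cancel  : ∀ u x v → (u ++ x ∷ x ∷ v) ≈ (u ++ v)
  commute : ∀ u v → (u ++ R₀ ∷ R₂ ∷ v) ≈ (u ++ R₂ ∷ R₀ ∷ v)

record Subgroup : Set₁ where
  field
    _∈H      : Word → Set
    resp     : ∀ {u v} → u ≈ v → u ∈H → v ∈H
    ∋e       : e ∈H
    ∙-closed : ∀ {u v} → u ∈H → v ∈H → (u · v) ∈H
    ⁻¹-closed : ∀ {u} → u ∈H → (u ⁻¹) ∈H
open Subgroup public

data Even : ℕ → Set where
  even-zero : Even zero
  even-ss   : ∀ {n} → Even n → Even (suc (suc n))

-- Γ⁺ : elements represented by words of even length (well defined,
-- since the relators have even length).
_∈Γ⁺ : Word → Set
w ∈Γ⁺ = Even (length w)

_⊆Γ⁺ : Subgroup → Set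
H ⊆Γ⁺ = ∀ w → (H ∈H) w → w ∈Γ⁺

Normal : Subgroup → Set
Normal H = ∀ g h → (H ∈H) h → (H ∈H) ((g ⁻¹) · (h · g))

_∈N_ : Word → Subgroup → Set
g ∈N H = ∀ h → ((H ∈H) h → (H ∈H) ((g ⁻¹) · (h · g)))
             × ((H ∈H) ((g ⁻¹) · (h · g)) → (H ∈H) h)

_∩Γ⁺-mem : Subgroup → Word → Set
(M ∩Γ⁺-mem) w = (M ∈H) w × w ∈Γ⁺

-- A normal subgroup has the whole group as normaliser. Γ⁺ is closed under
-- conjugation, since |g⁻¹ h g| = 2|g| + |h| has the parity of |h|; so when M
-- is normal, so is M⁺ = M ∩ Γ⁺, and N_Γ(M⁺) = Γ = N_Γ(M).
module Submission where

open import Defs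
open import Data.Product using (_×_; _,_)
open import Relation.Nullary using (¬_)
open import Data.Nat using (zero; suc; _+_)
open import Data.Nat.Properties using (+-suc; +-comm; +-assoc)
open import Data.List using ([]; _∷_; _++_; reverse; length)
open import Data.List.Properties
  using (++-assoc; ++-identityʳ; reverse-involutive; length-++; length-reverse; unfold-reverse)
open import Relation.Binary.Bundles using (Setoid)
open import Relation.Binary.PropositionalEquality
  using (_≡_; refl; sym; cong; cong₂; subst; module ≡-Reasoning)
import Relation.Binary.Reasoning.Setoid as SetoidReasoning

Even-double+ : ∀ a {b} → Even b → Even (a + a + b)
Even-double+ zero    p = p
Even-double+ (suc a) p rewrite +-suc a a = even-ss (Even-double+ a p)

length-conjugate : ∀ g h → length ((g ⁻¹) · (h · g)) ≡ length g + length g + length h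
length-conjugate g h = begin
  length (reverse g ++ h ++ g)          ≡⟨ length-++ (reverse g) ⟩
  length (reverse g) + length (h ++ g)  ≡⟨ cong₂ _+_ (length-reverse g) (length-++ h) ⟩
  length g + (length h + length g)      ≡⟨ cong (length g +_) (+-comm (length h) (length g)) ⟩
  length g + (length g + length h)      ≡⟨ +-assoc (length g) (length g) (length h) ⟨
  length g + length g + length h        ∎
  where open ≡-Reasoning

conjugate-∈Γ⁺ : ∀ g h → h ∈Γ⁺ → ((g ⁻¹) · (h · g)) ∈Γ⁺
conjugate-∈Γ⁺ g h p =
  subst Even (sym (length-conjugate g h)) (Even-double+ (length g) p)

Γ-setoid : Setoid _ _
Γ-setoid = record
  { Carrier       = Word
  ; _≈_           = _≈_
  ; isEquivalence = record { refl = ≈-refl ; sym = ≈-sym ; trans = ≈-trans }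
  }

open SetoidReasoning Γ-setoid

·-congˡ : ∀ a {u v} → u ≈ v → (a · u) ≈ (a · v)
·-congˡ a ≈-refl        = ≈-refl
·-congˡ a (≈-sym p)     = ≈-sym (·-congˡ a p)
·-congˡ a (≈-trans p q) = ≈-trans (·-congˡ a p) (·-congˡ a q)
·-congˡ a (cancel u x v) = begin
  a ++ u ++ x ∷ x ∷ v    ≡⟨ ++-assoc a u _ ⟨
  (a ++ u) ++ x ∷ x ∷ v  ≈⟨ cancel (a ++ u) x v ⟩
  (a ++ u) ++ v          ≡⟨ ++-assoc a u v ⟩
  a ++ u ++ v            ∎
·-congˡ a (commute u v) = begin
  a ++ u ++ R₀ ∷ R₂ ∷ v    ≡⟨ ++-assoc a u _ ⟨
  (a ++ u) ++ R₀ ∷ R₂ ∷ v  ≈⟨ commute (a ++ u) v ⟩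
  (a ++ u) ++ R₂ ∷ R₀ ∷ v  ≡⟨ ++-assoc a u _ ⟩
  a ++ u ++ R₂ ∷ R₀ ∷ v    ∎

·-congʳ : ∀ b {u v} → u ≈ v → (u · b) ≈ (v · b)
·-congʳ b ≈-refl        = ≈-refl
·-congʳ b (≈-sym p)     = ≈-sym (·-congʳ b p)
·-congʳ b (≈-trans p q) = ≈-trans (·-congʳ b p) (·-congʳ b q)
·-congʳ b (cancel u x v) = begin
  (u ++ x ∷ x ∷ v) ++ b  ≡⟨ ++-assoc u _ b ⟩
  u ++ x ∷ x ∷ v ++ b    ≈⟨ cancel u x (v ++ b) ⟩
  u ++ v ++ b            ≡⟨ ++-assoc u v b ⟨
  (u ++ v) ++ b          ∎
·-congʳ b (commute u v) = begin
  (u ++ R₀ ∷ R₂ ∷ v) ++ b  ≡⟨ ++-assoc u _ b ⟩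
  u ++ R₀ ∷ R₂ ∷ v ++ b    ≈⟨ commute u (v ++ b) ⟩
  u ++ R₂ ∷ R₀ ∷ v ++ b    ≡⟨ ++-assoc u _ b ⟨
  (u ++ R₂ ∷ R₀ ∷ v) ++ b  ∎

⁻¹-inverseˡ : ∀ g → ((g ⁻¹) · g) ≈ e
⁻¹-inverseˡ []      = ≈-refl
⁻¹-inverseˡ (x ∷ g) = begin
  reverse (x ∷ g) ++ x ∷ g        ≡⟨ cong (_++ x ∷ g) (unfold-reverse x g) ⟩
  (reverse g ++ x ∷ []) ++ x ∷ g  ≡⟨ ++-assoc (reverse g) (x ∷ []) (x ∷ g) ⟩
  reverse g ++ x ∷ x ∷ g          ≈⟨ cancel (reverse g) x g ⟩
  reverse g ++ g                  ≈⟨ ⁻¹-inverseˡ g ⟩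
  []                              ∎

⁻¹-inverseʳ : ∀ g → (g · (g ⁻¹)) ≈ e
⁻¹-inverseʳ g = subst (λ z → (z · (g ⁻¹)) ≈ e) (reverse-involutive g) (⁻¹-inverseˡ (g ⁻¹))

conjugate-by-inverse-cancels : ∀ g h → (((g ⁻¹) ⁻¹) · (((g ⁻¹) · (h · g)) · (g ⁻¹))) ≈ h
conjugate-by-inverse-cancels g h = begin
  ((g ⁻¹) ⁻¹) · (((g ⁻¹) · (h · g)) · (g ⁻¹))  ≡⟨ cong (_· (((g ⁻¹) · (h · g)) · (g ⁻¹))) (reverse-involutive g) ⟩
  g · (((g ⁻¹) · (h · g)) · (g ⁻¹))            ≡⟨ regroup ⟩
  (g · (g ⁻¹)) · (h · (g · (g ⁻¹)))            ≈⟨ ·-congʳ _ (⁻¹-inverseʳ g) ⟩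
  h · (g · (g ⁻¹))                             ≈⟨ ·-congˡ h (⁻¹-inverseʳ g) ⟩
  h · e                                        ≡⟨ ++-identityʳ h ⟩
  h                                            ∎
  where
  regroup : g · (((g ⁻¹) · (h · g)) · (g ⁻¹)) ≡ (g · (g ⁻¹)) · (h · (g · (g ⁻¹)))
  regroup rewrite ++-assoc (g ⁻¹) (h ++ g) (g ⁻¹) | ++-assoc h g (g ⁻¹)
                | ++-assoc g (g ⁻¹) (h ++ g ++ (g ⁻¹)) = refl

normal⇒∈N : ∀ H → Normal H → ∀ g → g ∈N H
normal⇒∈N H normal g h =
    normal g h
  , λ conj∈H → resp H (conjugate-by-inverse-cancels g h) (normal (g ⁻¹) _ conj∈H)

∩Γ⁺-normal : ∀ M M⁺ → (∀ w → (M⁺ ∈H) w → (M ∩Γ⁺-mem) w)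
           → (∀ w → (M ∩Γ⁺-mem) w → (M⁺ ∈H) w)
           → Normal M → Normal M⁺
∩Γ⁺-normal M M⁺ to from normal g h h∈M⁺ =
  let (h∈M , h∈Γ⁺) = to h h∈M⁺
  in from _ (normal g h h∈M , conjugate-∈Γ⁺ g h h∈Γ⁺)

lemma1 : (M : Subgroup) (M⁺ : Subgroup)
    → (∀ w → (M⁺ ∈H) w → (M ∩Γ⁺-mem) w)
    → (∀ w → (M ∩Γ⁺-mem) w → (M⁺ ∈H) w)
    → ¬ (M ⊆Γ⁺)
    → Normal M
    → ∀ g → (g ∈N M⁺ → g ∈N M) × (g ∈N M → g ∈N M⁺)
lemma1 M M⁺ to from _ normal g =
    (λ _ → normal⇒∈N M normal g)
  , (λ _ → normal⇒∈N M⁺ (∩Γ⁺-normal M M⁺ to from normal) g)
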